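{- Let $G$ be a pseudo $3$-regular graph. (i) If $i\in V(G)$ has degree $d_i=6$, then each neighbor $j$ of $i$ has degree $d_j=3$, and the multiset of degrees of the neighbors of $j$ is $\{6,2,1\}$. (ii) If $i\in V(G)$ has degree $d_i=5$, then each neighbor $j$ of $i$ has degree $d_j=3$, and the multiset of degrees of the neighbors of $j$ is $\{5,2,2\}$ or $\{5,3,1\}$. (iii) If $i\in V(G)$ has degree $d_i=4$, then the multiset of degrees of the neighbors of $i$ is $\{3,3,3,3\}$, $\{4,3,3,2\}$, or $\{4,4,2,2\}$.
   Context: All graphs are finite, simple and without isolated vertices. For a vertex $i$, $d_i$ is its degree and $m_i=d_i^{ -1}\sum_{j:\, ji\in E(G)} d_j$ is its average $2$-degree. A graph is $k$-harmonic if $m_i=k$ for all vertices $i$; it is pseudo $k$-regular if it is $k$-harmonic but not $k$-regular. -}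

module Defs where

open import Data.Nat using (ℕ; _*_; _<_)
open import Data.Bool using (Bool; true; false; T)
open import Data.Fin using (Fin)
open import Data.List using (List; filter; allFin; length; map)
open import Data.Nat.ListAction using (sum)
open import Data.Product using (∃; _×_)
open import Relation.Nullary using (¬_; T?)
open import Relation.Binary.PropositionalEquality using (_≡_)

record Graph (n : ℕ) : Set where
  field
    adj    : Fin n → Fin n → Bool
    sym    : ∀ i j → adj i j ≡ adj j i
    irrefl : ∀ i → adj i i ≡ false
open Graph public

module _ {n : ℕ} (G : Graph n) where

  Adjacent : Fin n → Fin n → Set
  Adjacent i j = adj G i j ≡ true

  neighbours : Fin n → List (Fin n)
  neighbours i = filter (λ j → T? (adj G i j)) (allFin n)

  degree : Fin n → ℕ
  degree i = length (neighbours i)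

  nbrDegrees : Fin n → List ℕ
  nbrDegrees i = map degree (neighbours i)

  NoIsolated : Set
  NoIsolated = ∀ i → 0 < degree i

  -- m_i = k, written without division: sum_{j ~ i} d_j = k * d_i (d_i > 0)
  Harmonic : ℕ → Set
  Harmonic k = ∀ i → sum (nbrDegrees i) ≡ k * degree i

  Regular : ℕ → Set
  Regular k = ∀ i → degree i ≡ k

  PseudoRegular : ℕ → Set
  PseudoRegular k = Harmonic k × ¬ Regular k

module Submission where

-- Everything rests on one observation about a k-harmonic graph without
-- isolated vertices: if j is a neighbour of i, the neighbour-degree list of j
-- consists of d_i together with d_j - 1 further positive entries summing to
-- k·d_j - d_i (the "remainder" of j at i).  From it we derive, for general k,
--   * d_i + d_j ≤ 1 + k·d_j for adjacent i and j,
--   * the neighbour of a vertex of degree 1 has degree k,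
--   * if all neighbours of i have degree ≥ k, they all have degree exactly k.
-- For k = 3 this shows that every neighbour of a vertex of degree ≥ 5 has
-- degree 3: its degree is at least 2, and a neighbour of degree 2 would have a
-- leaf as its other neighbour, which forces degree 3.  Parts (i) and (ii) then
-- read off the remainder of such a neighbour: two positive numbers with sum 3,
-- respectively 4.  For part (iii) the neighbours of a degree-4 vertex have
-- degrees in {2,3,4} with mean 3; sorting such a list into r fours, q threes
-- and p twos, mean 3 forces r = p, which leaves three multisets.

open import Defs hiding (sym)
open import Data.Nat using (ℕ; zero; suc; _+_; _*_; _∸_; _≤_; z≤n; s≤s)
open import Data.Nat.Properties
  using ( +-suc; +-identityʳ; *-identityˡ; *-identityʳ; *-zeroʳ; *-suc
        ; +-cancelˡ-≡; +-cancelʳ-≡; +-cancelʳ-≤; +-monoʳ-≤; +-monoˡ-≤; +-mono-≤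
        ; ≤⇒≤ᵇ; ≤-antisym; ≤-trans; ≤-reflexive; <⇒≤; n≤1+n; ≤∧≢⇒<; ≮⇒≥; m+1+n≢0
        ; module ≤-Reasoning )
open import Data.Nat.Tactic.RingSolver using (solve-∀)
open import Data.Nat.ListAction using (sum)
open import Data.Nat.ListAction.Properties using (sum-++; sum-↭)
open import Data.Bool.Properties using (T-≡)
open import Data.Fin using (Fin)
open import Data.List using (List; []; _∷_; _++_; length; replicate; allFin)
open import Data.List.Properties using (length-map; length-++; length-replicate)
open import Data.List.Relation.Unary.All as All using (All; []; _∷_)
open import Data.List.Membership.Propositional using (_∈_)
open import Data.List.Membership.Propositional.Properties
  using (∈-filter⁺; ∈-filter⁻; ∈-allFin; ∈-map⁺; ∈-map⁻; ∈-∃++)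
open import Data.List.Relation.Binary.Permutation.Propositional
  using (_↭_; ↭-refl; ↭-prep; ↭-swap; ↭-trans; ↭-sym)
open import Data.List.Relation.Binary.Permutation.Propositional.Properties
  using (All-resp-↭; ↭-length; shift; ++⁺ˡ)
open import Data.Product using (_×_; _,_; ∃; proj₂)
open import Data.Sum using (_⊎_; inj₁; inj₂)
import Data.Sum as Sum
open import Data.Empty using (⊥; ⊥-elim)
open import Function.Bundles using (Equivalence)
open import Relation.Nullary using (T?; contradiction)
open import Relation.Binary.PropositionalEquality
  using (_≡_; _≢_; refl; sym; trans; cong; cong₂; module ≡-Reasoning)

extract : ∀ {A : Set} {x : A} {xs : List A} → x ∈ xs → ∃ λ ys → xs ↭ x ∷ ys
extract x∈xs with ys , zs , refl ← ∈-∃++ x∈xs = ys ++ zs , shift _ ys zs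

sum-lowerBound : ∀ {k xs} → All (k ≤_) xs → k * length xs ≤ sum xs
sum-lowerBound {k} [] = ≤-reflexive (*-zeroʳ k)
sum-lowerBound {k} {y ∷ ys} (k≤y ∷ k≤ys) = begin
  k * suc (length ys)  ≡⟨ *-suc k (length ys) ⟩
  k + k * length ys    ≤⟨ +-mono-≤ k≤y (sum-lowerBound k≤ys) ⟩
  y + sum ys           ∎
  where open ≤-Reasoning

allEqual-atLowerBound : ∀ {k xs} → All (k ≤_) xs → sum xs ≡ k * length xs → All (_≡ k) xs
allEqual-atLowerBound [] _ = []
allEqual-atLowerBound {k} {y ∷ ys} (k≤y ∷ k≤ys) total = y≡k ∷ allEqual-atLowerBound k≤ys rest
  where
  total′ : y + sum ys ≡ k + k * length ys
  total′ = trans total (*-suc k (length ys))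

  y≡k : y ≡ k
  y≡k = ≤-antisym (+-cancelʳ-≤ (k * length ys) y k y+bound≤k+bound) k≤y
    where
    open ≤-Reasoning
    y+bound≤k+bound : y + k * length ys ≤ k + k * length ys
    y+bound≤k+bound = begin
      y + k * length ys  ≤⟨ +-monoʳ-≤ y (sum-lowerBound k≤ys) ⟩
      y + sum ys         ≡⟨ total′ ⟩
      k + k * length ys  ∎

  rest : sum ys ≡ k * length ys
  rest = +-cancelˡ-≡ k _ _ (trans (cong (_+ sum ys) (sym y≡k)) total′)

-- Replacing a summand by a lower bound preserves an upper bound.  In the
-- arithmetic facts below, the resulting false numeral inequalities are refuted
-- by evaluating them with _≤ᵇ_.
lowerSummand : ∀ {m a d s} → m ≤ a → a + d ≤ s → m + d ≤ s
lowerSummand {d = d} m≤a bound = ≤-trans (+-monoˡ-≤ d m≤a) bound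

atLeastTwo : ∀ {a} d → 4 ≤ a → a + d ≤ suc (3 * d) → 2 ≤ d
atLeastTwo 0 4≤a bound = ⊥-elim (≤⇒≤ᵇ (lowerSummand 4≤a bound))
atLeastTwo 1 4≤a bound = ⊥-elim (≤⇒≤ᵇ (lowerSummand 4≤a bound))
atLeastTwo (suc (suc d)) _ _ = s≤s (s≤s z≤n)

completesSix : ∀ {a w} → 5 ≤ a → 1 ≤ w → a + w ≡ 6 → w ≡ 1
completesSix {w = suc zero} _ _ _ = refl
completesSix {w = suc (suc w)} 5≤a _ total =
  ⊥-elim (≤⇒≤ᵇ (lowerSummand 5≤a (≤-reflexive total)))

pairSum3 : ∀ b c → 1 ≤ b → 1 ≤ c → b + c ≡ 3 → b ∷ c ∷ [] ↭ 2 ∷ 1 ∷ []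
pairSum3 1 _ _ _ refl = ↭-swap 1 2 ↭-refl
pairSum3 2 _ _ _ refl = ↭-refl
pairSum3 (suc (suc (suc b))) _ _ (s≤s _) total = ⊥-elim (m+1+n≢0 b (cong (_∸ 3) total))

pairSum4 : ∀ b c → 1 ≤ b → 1 ≤ c → b + c ≡ 4 →
  b ∷ c ∷ [] ↭ 2 ∷ 2 ∷ [] ⊎ b ∷ c ∷ [] ↭ 3 ∷ 1 ∷ []
pairSum4 1 _ _ _ refl = inj₂ (↭-swap 1 3 ↭-refl)
pairSum4 2 _ _ _ refl = inj₁ ↭-refl
pairSum4 3 _ _ _ refl = inj₂ ↭-refl
pairSum4 (suc (suc (suc (suc b)))) _ _ (s≤s _) total = ⊥-elim (m+1+n≢0 b (cong (_∸ 4) total))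

data Mid : ℕ → Set where
  two   : Mid 2
  three : Mid 3
  four  : Mid 4

mid : ∀ {d} → 2 ≤ d → d ≤ 4 → Mid d
mid {2} _ _ = two
mid {3} _ _ = three
mid {4} _ _ = four
mid {1} (s≤s ()) _
mid {suc (suc (suc (suc (suc _))))} _ (s≤s (s≤s (s≤s (s≤s ()))))

canonical : ℕ → ℕ → ℕ → List ℕ
canonical r q p = replicate r 4 ++ replicate q 3 ++ replicate p 2

record Sorted (L : List ℕ) : Set where
  constructor sorted
  field
    fours threes twos : ℕ
    perm              : L ↭ canonical fours threes twos

sortMid : ∀ {L} → All Mid L → Sorted L
sortMid [] = sorted 0 0 0 ↭-refl
sortMid (four ∷ mids) with sorted r q p π ← sortMid mids = sorted (suc r) q p (↭-prep 4 π)
sortMid (three ∷ mids) with sorted r q p π ← sortMid mids =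
  sorted r (suc q) p (↭-trans (↭-prep 3 π) (↭-sym (shift 3 (replicate r 4) _)))
sortMid (two ∷ mids) with sorted r q p π ← sortMid mids =
  sorted r q (suc p) (↭-trans (↭-prep 2 π) (↭-sym (↭-trans
    (++⁺ˡ (replicate r 4) (shift 2 (replicate q 3) (replicate p 2)))
    (shift 2 (replicate r 4) _))))

sum-replicate : ∀ n x → sum (replicate n x) ≡ n * x
sum-replicate zero    x = refl
sum-replicate (suc n) x = cong (x +_) (sum-replicate n x)

length-canonical : ∀ r q p → length (canonical r q p) ≡ r + (q + p)
length-canonical r q p = begin
  length (canonical r q p)                                        ≡⟨ length-++ (replicate r 4) ⟩
  length (replicate r 4) + length (replicate q 3 ++ replicate p 2) ≡⟨ cong (length (replicate r 4) +_) (length-++ (replicate q 3)) ⟩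
  length (replicate r 4) + (length (replicate q 3) + length (replicate p 2))
    ≡⟨ cong₂ _+_ (length-replicate r) (cong₂ _+_ (length-replicate q) (length-replicate p)) ⟩
  r + (q + p)                                                      ∎
  where open ≡-Reasoning

sum-canonical : ∀ r q p → sum (canonical r q p) ≡ r * 4 + (q * 3 + p * 2)
sum-canonical r q p = begin
  sum (canonical r q p)                                        ≡⟨ sum-++ (replicate r 4) _ ⟩
  sum (replicate r 4) + sum (replicate q 3 ++ replicate p 2)   ≡⟨ cong (sum (replicate r 4) +_) (sum-++ (replicate q 3) _) ⟩
  sum (replicate r 4) + (sum (replicate q 3) + sum (replicate p 2))
    ≡⟨ cong₂ _+_ (sum-replicate r 4) (cong₂ _+_ (sum-replicate q 3) (sum-replicate p 2)) ⟩
  r * 4 + (q * 3 + p * 2)                                      ∎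
  where open ≡-Reasoning

meanThree⇒balanced : ∀ r q p → r * 4 + (q * 3 + p * 2) ≡ 3 * (r + (q + p)) → r ≡ p
meanThree⇒balanced r q p mean = +-cancelʳ-≡ common r p (begin
  r + common               ≡⟨ expandFours r q p ⟩
  r * 4 + (q * 3 + p * 2)  ≡⟨ mean ⟩
  3 * (r + (q + p))        ≡⟨ expandMean r q p ⟩
  p + common               ∎)
  where
  open ≡-Reasoning
  common : ℕ
  common = r * 3 + q * 3 + p * 2
  expandFours : ∀ r q p → r + (r * 3 + q * 3 + p * 2) ≡ r * 4 + (q * 3 + p * 2)
  expandFours = solve-∀
  expandMean : ∀ r q p → 3 * (r + (q + p)) ≡ p + (r * 3 + q * 3 + p * 2)
  expandMean = solve-∀

MeanThreeQuadruple : List ℕ → Set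
MeanThreeQuadruple L =
  L ↭ 3 ∷ 3 ∷ 3 ∷ 3 ∷ [] ⊎ L ↭ 4 ∷ 3 ∷ 3 ∷ 2 ∷ [] ⊎ L ↭ 4 ∷ 4 ∷ 2 ∷ 2 ∷ []

balancedQuadruple : ∀ p q → p * 2 + q ≡ 4 → MeanThreeQuadruple (canonical p q p)
balancedQuadruple 0 _ refl = inj₁ ↭-refl
balancedQuadruple 1 _ refl = inj₂ (inj₁ ↭-refl)
balancedQuadruple 2 _ refl = inj₂ (inj₂ ↭-refl)
balancedQuadruple (suc (suc (suc p))) q ()

quadruplesOfMeanThree : ∀ {L} → All Mid L → length L ≡ 4 → sum L ≡ 12 → MeanThreeQuadruple L
quadruplesOfMeanThree mids len total with sorted r q p π ← sortMid mids =
  Sum.map (↭-trans π) (Sum.map (↭-trans π) (↭-trans π))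
    (balanced (meanThree⇒balanced r q p (trans sumRQP (cong (3 *_) (sym lengthRQP)))))
  where
  lengthRQP : r + (q + p) ≡ 4
  lengthRQP = trans (sym (length-canonical r q p)) (trans (sym (↭-length π)) len)
  sumRQP : r * 4 + (q * 3 + p * 2) ≡ 12
  sumRQP = trans (sym (sum-canonical r q p)) (trans (sym (sum-↭ π)) total)
  regroup : ∀ p q → p + (q + p) ≡ p * 2 + q
  regroup = solve-∀
  balanced : r ≡ p → MeanThreeQuadruple (canonical r q p)
  balanced refl = balancedQuadruple r q (trans (sym (regroup r q)) lengthRQP)

module Neighbourhood {n : ℕ} (G : Graph n) where

  adjacent-sym : ∀ {i j} → Adjacent G i j → Adjacent G j i
  adjacent-sym {i} {j} i~j = trans (Graph.sym G j i) i~j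

  ∈neighbours⇒adjacent : ∀ {i j} → j ∈ neighbours G i → Adjacent G i j
  ∈neighbours⇒adjacent {i} j∈ =
    Equivalence.to T-≡ (proj₂ (∈-filter⁻ (λ k → T? (adj G i k)) {xs = allFin n} j∈))

  degree∈nbrDegrees : ∀ {i j} → Adjacent G j i → degree G i ∈ nbrDegrees G j
  degree∈nbrDegrees {i} {j} j~i =
    ∈-map⁺ (degree G) (∈-filter⁺ (λ k → T? (adj G j k)) (∈-allFin i) (Equivalence.from T-≡ j~i))

  length-nbrDegrees : ∀ j → length (nbrDegrees G j) ≡ degree G j
  length-nbrDegrees j = length-map (degree G) (neighbours G j)

  NeighbourDegree : Fin n → ℕ → Set
  NeighbourDegree j x = ∃ λ ℓ → Adjacent G j ℓ × degree G ℓ ≡ x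

  nbrDegrees-witnessed : ∀ j → All (NeighbourDegree j) (nbrDegrees G j)
  nbrDegrees-witnessed j = All.tabulate witness
    where
    witness : ∀ {x} → x ∈ nbrDegrees G j → NeighbourDegree j x
    witness x∈ with ℓ , ℓ∈ , refl ← ∈-map⁻ (degree G) x∈ = ℓ , ∈neighbours⇒adjacent ℓ∈ , refl

  all-nbrDegrees : ∀ {P : ℕ → Set} j → (∀ ℓ → Adjacent G j ℓ → P (degree G ℓ)) → All P (nbrDegrees G j)
  all-nbrDegrees j f = All.map (λ { (ℓ , j~ℓ , refl) → f ℓ j~ℓ }) (nbrDegrees-witnessed j)

module HarmonicGraph {n : ℕ} (G : Graph n) (noIsolated : NoIsolated G) (k : ℕ) (harmonic : Harmonic G k) where
  open Neighbourhood G

  record Remainder (j i : Fin n) : Set where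
    field
      rest : List ℕ
      perm : nbrDegrees G j ↭ degree G i ∷ rest

    length-rest : suc (length rest) ≡ degree G j
    length-rest = trans (sym (↭-length perm)) (length-nbrDegrees j)

    sum-rest : degree G i + sum rest ≡ k * degree G j
    sum-rest = trans (sym (sum-↭ perm)) (harmonic j)

    all-rest : ∀ {P : ℕ → Set} → All P (nbrDegrees G j) → All P rest
    all-rest all = All.tail (All-resp-↭ perm all)

    positive-rest : All (1 ≤_) rest
    positive-rest = all-rest (all-nbrDegrees j (λ ℓ _ → noIsolated ℓ))

  remainder : ∀ {i j} → Adjacent G j i → Remainder j i
  remainder j~i with rest , perm ← extract (degree∈nbrDegrees j~i) = record { rest = rest ; perm = perm }

  -- d_i + d_j ≤ 1 + k·d_j: the other d_j - 1 neighbours of j contribute at least 1 each.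
  neighbourBound : ∀ {i j} → Adjacent G j i → degree G i + degree G j ≤ suc (k * degree G j)
  neighbourBound {i} {j} j~i = begin
    degree G i + degree G j         ≡⟨ cong (degree G i +_) (sym length-rest) ⟩
    degree G i + suc (length rest)  ≡⟨ +-suc (degree G i) (length rest) ⟩
    suc (degree G i + length rest)  ≤⟨ s≤s (+-monoʳ-≤ (degree G i) length≤sum) ⟩
    suc (degree G i + sum rest)     ≡⟨ cong suc sum-rest ⟩
    suc (k * degree G j)            ∎
    where
    open Remainder (remainder j~i)
    open ≤-Reasoning
    length≤sum : length rest ≤ sum rest
    length≤sum = ≤-trans (≤-reflexive (sym (*-identityˡ _))) (sum-lowerBound positive-rest)

  leafNeighbour : ∀ {ℓ j} → degree G ℓ ≡ 1 → Adjacent G ℓ j → degree G j ≡ k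
  leafNeighbour {ℓ} {j} leaf ℓ~j = onlyEntry rest (trans length-rest leaf) sum-rest
    where
    open Remainder (remainder ℓ~j)
    onlyEntry : ∀ R → suc (length R) ≡ 1 → degree G j + sum R ≡ k * degree G ℓ → degree G j ≡ k
    onlyEntry [] _ total = begin
      degree G j      ≡⟨ sym (+-identityʳ _) ⟩
      degree G j + 0  ≡⟨ total ⟩
      k * degree G ℓ  ≡⟨ cong (k *_) leaf ⟩
      k * 1           ≡⟨ *-identityʳ k ⟩
      k               ∎
      where open ≡-Reasoning

  -- If all neighbours of i have degree ≥ k, they all have degree exactly k,
  -- since their degrees average to k.
  neighboursAtLeast⇒equal : ∀ {i} → (∀ j → Adjacent G i j → k ≤ degree G j) →
    ∀ {j} → Adjacent G i j → degree G j ≡ k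
  neighboursAtLeast⇒equal {i} atLeast i~j =
    All.lookup (allEqual-atLowerBound (all-nbrDegrees i atLeast) total) (degree∈nbrDegrees i~j)
    where
    total : sum (nbrDegrees G i) ≡ k * length (nbrDegrees G i)
    total = trans (harmonic i) (cong (k *_) (sym (length-nbrDegrees i)))

module ThreeHarmonic {n : ℕ} (G : Graph n) (noIsolated : NoIsolated G) (harmonic : Harmonic G 3) where
  open Neighbourhood G
  open HarmonicGraph G noIsolated 3 harmonic

  -- neighbours of a vertex of degree ≥ 4 have degree ≥ 2, by d_i ≤ 1 + 2·d_j
  neighbourAtLeastTwo : ∀ {i j} → 4 ≤ degree G i → Adjacent G i j → 2 ≤ degree G j
  neighbourAtLeastTwo {j = j} 4≤dᵢ i~j = atLeastTwo (degree G j) 4≤dᵢ (neighbourBound (adjacent-sym i~j))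

  -- A vertex of degree ≥ 5 has no neighbour j of degree 2: the other neighbour ℓ
  -- of j would have degree 6 - d_i = 1, and then j would have degree 3.
  noDegreeTwoNeighbour : ∀ {i j} → 5 ≤ degree G i → Adjacent G i j → degree G j ≢ 2
  noDegreeTwoNeighbour {i} {j} 5≤dᵢ i~j d₂ =
    singleRest rest (trans length-rest d₂) (trans sum-rest (cong (3 *_) d₂))
      (all-rest (nbrDegrees-witnessed j)) positive-rest
    where
    open Remainder (remainder (adjacent-sym i~j))
    singleRest : ∀ R → suc (length R) ≡ 2 → degree G i + sum R ≡ 6 →
      All (NeighbourDegree j) R → All (1 ≤_) R → ⊥
    singleRest (_ ∷ []) _ total ((ℓ , j~ℓ , refl) ∷ []) (1≤dℓ ∷ []) =
      contradiction (trans (sym d₂) (leafNeighbour leaf (adjacent-sym j~ℓ))) λ ()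
      where
      leaf : degree G ℓ ≡ 1
      leaf = completesSix 5≤dᵢ 1≤dℓ (trans (cong (degree G i +_) (sym (+-identityʳ _))) total)

  highDegreeNeighbours : ∀ {i j} → 5 ≤ degree G i → Adjacent G i j → degree G j ≡ 3
  highDegreeNeighbours {i} 5≤dᵢ = neighboursAtLeast⇒equal atLeastThree
    where
    atLeastThree : ∀ j → Adjacent G i j → 3 ≤ degree G j
    atLeastThree j i~j = ≤∧≢⇒< (neighbourAtLeastTwo (<⇒≤ 5≤dᵢ) i~j)
                                (λ 2≡dⱼ → noDegreeTwoNeighbour 5≤dᵢ i~j (sym 2≡dⱼ))

  remainderPair : ∀ {i j a} → Adjacent G j i → degree G i ≡ a → degree G j ≡ 3 →
    ∃ λ b → ∃ λ c → nbrDegrees G j ↭ a ∷ b ∷ c ∷ [] × 1 ≤ b × 1 ≤ c × a + (b + c) ≡ 9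
  remainderPair {i} {j} j~i refl d₃ =
    pairOf rest perm (trans length-rest d₃) (trans sum-rest (cong (3 *_) d₃)) positive-rest
    where
    open Remainder (remainder j~i)
    pairOf : ∀ R → nbrDegrees G j ↭ degree G i ∷ R → suc (length R) ≡ 3 → degree G i + sum R ≡ 9 →
      All (1 ≤_) R → ∃ λ b → ∃ λ c →
        nbrDegrees G j ↭ degree G i ∷ b ∷ c ∷ [] × 1 ≤ b × 1 ≤ c × degree G i + (b + c) ≡ 9
    pairOf (b ∷ c ∷ []) π _ total (1≤b ∷ 1≤c ∷ []) =
      b , c , π , 1≤b , 1≤c , trans (cong (λ x → degree G i + (b + x)) (sym (+-identityʳ c))) total

  part-i : ∀ i → degree G i ≡ 6 → ∀ j → Adjacent G i j →
    degree G j ≡ 3 × nbrDegrees G j ↭ 6 ∷ 2 ∷ 1 ∷ []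
  part-i i d₆ j i~j = d₃ , neighbourPattern
    where
    d₃ : degree G j ≡ 3
    d₃ = highDegreeNeighbours (≤-trans (n≤1+n 5) (≤-reflexive (sym d₆))) i~j
    neighbourPattern : nbrDegrees G j ↭ 6 ∷ 2 ∷ 1 ∷ []
    neighbourPattern with b , c , π , 1≤b , 1≤c , total ← remainderPair (adjacent-sym i~j) d₆ d₃ =
      ↭-trans π (↭-prep 6 (pairSum3 b c 1≤b 1≤c (+-cancelˡ-≡ 6 (b + c) 3 total)))

  part-ii : ∀ i → degree G i ≡ 5 → ∀ j → Adjacent G i j →
    degree G j ≡ 3 × (nbrDegrees G j ↭ 5 ∷ 2 ∷ 2 ∷ [] ⊎ nbrDegrees G j ↭ 5 ∷ 3 ∷ 1 ∷ [])
  part-ii i d₅ j i~j = d₃ , neighbourPattern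
    where
    d₃ : degree G j ≡ 3
    d₃ = highDegreeNeighbours (≤-reflexive (sym d₅)) i~j
    neighbourPattern : nbrDegrees G j ↭ 5 ∷ 2 ∷ 2 ∷ [] ⊎ nbrDegrees G j ↭ 5 ∷ 3 ∷ 1 ∷ []
    neighbourPattern with b , c , π , 1≤b , 1≤c , total ← remainderPair (adjacent-sym i~j) d₅ d₃ =
      Sum.map (λ σ → ↭-trans π (↭-prep 5 σ)) (λ σ → ↭-trans π (↭-prep 5 σ))
        (pairSum4 b c 1≤b 1≤c (+-cancelˡ-≡ 5 (b + c) 4 total))

  -- (iii): the neighbours of a degree-4 vertex have degrees in {2, 3, 4}: at least 2 by
  -- the neighbour bound, and at most 4 since a neighbour of degree ≥ 5 would force
  -- d_i = 3.  Their mean is 3.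
  part-iii : ∀ i → degree G i ≡ 4 → MeanThreeQuadruple (nbrDegrees G i)
  part-iii i d₄ = quadruplesOfMeanThree (all-nbrDegrees i admissible)
    (trans (length-nbrDegrees i) d₄) (trans (harmonic i) (cong (3 *_) d₄))
    where
    admissible : ∀ j → Adjacent G i j → Mid (degree G j)
    admissible j i~j = mid (neighbourAtLeastTwo (≤-reflexive (sym d₄)) i~j) atMostFour
      where
      atMostFour : degree G j ≤ 4
      atMostFour = ≮⇒≥ λ 5≤dⱼ → contradiction
        (trans (sym d₄) (highDegreeNeighbours 5≤dⱼ (adjacent-sym i~j))) λ ()

corollary4p10 : ∀ {n : ℕ} (G : Graph n) → NoIsolated G → PseudoRegular G 3 →
    (∀ i → degree G i ≡ 6 → ∀ j → Adjacent G i j →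
      degree G j ≡ 3 × nbrDegrees G j ↭ (6 ∷ 2 ∷ 1 ∷ []))
    × (∀ i → degree G i ≡ 5 → ∀ j → Adjacent G i j →
      degree G j ≡ 3 × (nbrDegrees G j ↭ (5 ∷ 2 ∷ 2 ∷ []) ⊎ nbrDegrees G j ↭ (5 ∷ 3 ∷ 1 ∷ [])))
    × (∀ i → degree G i ≡ 4 →
      nbrDegrees G i ↭ (3 ∷ 3 ∷ 3 ∷ 3 ∷ [])
      ⊎ nbrDegrees G i ↭ (4 ∷ 3 ∷ 3 ∷ 2 ∷ [])
      ⊎ nbrDegrees G i ↭ (4 ∷ 4 ∷ 2 ∷ 2 ∷ []))
corollary4p10 G noIsolated (harmonic , _) = part-i , part-ii , part-iii
  where open ThreeHarmonic G noIsolated harmonic
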